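{- Every (closed) constant type of the guarded $\lambda$-calculus denotes a constant object of the topos of trees, i.e. an object all of whose restriction maps are bijections.
   Context: Types of the guarded $\lambda$-calculus: $A ::= \alpha \mid \mathbf{N} \mid \mathbf{1} \mid A\times A \mid \mathbf{0} \mid A+A \mid A\to A \mid \mu\alpha.A \mid \blacktriangleright A \mid \blacksquare A$, with $\mu\alpha.A$ formed only when $\alpha$ is guarded in $A$ (every occurrence beneath a $\blacktriangleright$) and $\blacksquare A$ only for closed $A$. A type is constant if every occurrence of $\blacktriangleright$ in its syntax tree lies beneath an occurrence of $\blacksquare$. The topos of trees $\mathcal S$: objects are families of sets $X_1,X_2,\dots$ with restriction maps $r^X_i:X_{i+1}\to X_i$, morphisms natural families of functions; products/coproducts pointwise, exponentials as for presheaves on $\omega$. $\Delta Z$ is the object with all sets $Z$ and identity restrictions. $\blacksquare X=\Delta(\mathrm{Hom}_{\mathcal S}(1,X))$; $(\blacktriangleright X)_1=\{*\}$, $(\blacktriangleright X)_{i+1}=X_i$. Denotation of types (as functors $(\mathcal S^{op}\times\mathcal S)^n\to\mathcal S$ for types with $n$ free variables): variables project to their covariant argument; $[\![\mathbf N]\!]=\Delta\mathbb N$, $[\![\mathbf 1]\!]=\Delta\{*\}$, $[\![\mathbf 0]\!]=\Delta\emptyset$; $\times,+$ pointwise, $\to$ by exponential (with variance swap); $\blacktriangleright,\blacksquare$ by composing with the functors above; $[\![\mu\alpha.A]\!](\vec W)$ the unique up to isomorphism $X$ with $[\![A]\!](\vec W,X,X)\cong X$. -}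

module Defs where

open import Level using (0ℓ)
open import Data.Nat using (ℕ; zero; suc; _≤_)
open import Data.Nat.Properties using (m≤n⇒m≤1+n)
open import Data.Fin using (Fin; zero; suc)
open import Data.Unit using (⊤; tt)
open import Data.Empty using (⊥)
open import Data.Product using (Σ; _×_; _,_; proj₁; proj₂)
open import Data.Sum using (_⊎_)
import Data.Sum
import Data.Sum.Relation.Binary.Pointwise as Pw
open import Relation.Binary using (Setoid)
open import Relation.Nullary using (¬_)
open import Relation.Binary.PropositionalEquality as ≡ using (_≡_)
open import Function.Bundles using (Func)
open import Function.Definitions using (Bijective)
open import Data.Product.Relation.Binary.Pointwise.NonDependent using (×-setoid)
open import Data.Sum.Relation.Binary.Pointwise using (⊎-setoid)

-- The topos of trees S, with setoid-valued components.
-- Indices are 0-based: X 0, X 1, ... stand for the paper's X_1, X_2, ...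
-- restr n : X (suc n) → X n is the restriction map r^X.

record Obj : Set₁ where
  field
    X     : ℕ → Setoid 0ℓ 0ℓ
    restr : (n : ℕ) → Func (X (suc n)) (X n)
open Obj public

module _ (A : Obj) where
  open Setoid
  ∣_∣ : ℕ → Set
  ∣_∣ n = Carrier (X A n)
  eq : (n : ℕ) → ∣_∣ n → ∣_∣ n → Set
  eq n = _≈_ (X A n)
  r : (n : ℕ) → ∣_∣ (suc n) → ∣_∣ n
  r n = Func.to (restr A n)

record Hom (A B : Obj) : Set where
  field
    comp : (n : ℕ) → Func (X A n) (X B n)
    nat  : (n : ℕ) (x : ∣ A ∣ (suc n)) →
           eq B n (r B n (Func.to (comp (suc n)) x)) (Func.to (comp n) (r A n x))
open Hom public

record _≅_ (A B : Obj) : Set where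
  field
    to      : Hom A B
    from    : Hom B A
    from∘to : (n : ℕ) (x : ∣ A ∣ n) →
              eq A n (Func.to (comp from n) (Func.to (comp to n) x)) x
    to∘from : (n : ℕ) (y : ∣ B ∣ n) →
              eq B n (Func.to (comp to n) (Func.to (comp from n) y)) y

IsConstant : Obj → Set
IsConstant A = (n : ℕ) → Bijective (eq A (suc n)) (eq A n) (r A n)

Δ : Set → Obj
Δ Z = record { X = λ _ → ≡.setoid Z ; restr = λ _ → record { to = λ z → z ; cong = λ p → p } }

𝟙 : Obj
𝟙 = Δ ⊤

_×ₒ_ : Obj → Obj → Obj
A ×ₒ B = record
  { X = λ n → ×-setoid (X A n) (X B n)
  ; restr = λ n → record
      { to = λ p → r A n (proj₁ p) , r B n (proj₂ p)
      ; cong = λ e → Func.cong (restr A n) (proj₁ e) , Func.cong (restr B n) (proj₂ e) } }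

_+ₒ_ : Obj → Obj → Obj
A +ₒ B = record
  { X = λ n → ⊎-setoid (X A n) (X B n)
  ; restr = λ n → record
      { to = Data.Sum.map (r A n) (r B n)
      ; cong = Pw.map (Func.cong (restr A n)) (Func.cong (restr B n)) } }

-- exponential of presheaves on ω:
-- (B^A)_n = natural transformations y(n) × A → B, i.e. families
-- f k (p : k ≤ n) : A_k → B_k, respecting the setoid equalities (all proofs of k ≤ n
-- being identified, as y(n)_k is a singleton) and natural in k.
record ExpElt (A B : Obj) (n : ℕ) : Set where
  field
    fun  : (k : ℕ) → k ≤ n → ∣ A ∣ k → ∣ B ∣ k
    cong : (k : ℕ) (p q : k ≤ n) (x y : ∣ A ∣ k) → eq A k x y → eq B k (fun k p x) (fun k q y)
    natl : (k : ℕ) (p : suc k ≤ n) (q : k ≤ n) (x : ∣ A ∣ (suc k)) →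
           eq B k (r B k (fun (suc k) p x)) (fun k q (r A k x))
open ExpElt public

ExpSetoid : (A B : Obj) (n : ℕ) → Setoid 0ℓ 0ℓ
ExpSetoid A B n = record
  { Carrier = ExpElt A B n
  ; _≈_ = λ f g → (k : ℕ) (p : k ≤ n) (x : ∣ A ∣ k) → eq B k (fun f k p x) (fun g k p x)
  ; isEquivalence = record
      { refl = λ {f} k p x → Setoid.refl (X B k)
      ; sym = λ e k p x → Setoid.sym (X B k) (e k p x)
      ; trans = λ e e' k p x → Setoid.trans (X B k) (e k p x) (e' k p x) } }

_⇒ₒ_ : Obj → Obj → Obj
A ⇒ₒ B = record
  { X = ExpSetoid A B
  ; restr = λ n → record
      { to = λ f → record
          { fun = λ k p → fun f k (m≤n⇒m≤1+n p)
          ; cong = λ k p q → cong f k (m≤n⇒m≤1+n p) (m≤n⇒m≤1+n q)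
          ; natl = λ k p q → natl f k (m≤n⇒m≤1+n p) (m≤n⇒m≤1+n q) }
      ; cong = λ e k p → e k (m≤n⇒m≤1+n p) } }

▶X : Obj → Setoid 0ℓ 0ℓ → ℕ → Setoid 0ℓ 0ℓ
▶X A T zero = T
▶X A T (suc n) = X A n

▶ₒ : Obj → Obj
▶ₒ A = record { X = ▶X A (≡.setoid ⊤) ; restr = rs }
  where
  rs : (n : ℕ) → Func (▶X A (≡.setoid ⊤) (suc n)) (▶X A (≡.setoid ⊤) n)
  rs zero = record { to = λ _ → tt ; cong = λ _ → ≡.refl }
  rs (suc n) = restr A n

GlobalSetoid : Obj → Setoid 0ℓ 0ℓ
GlobalSetoid A = record
  { Carrier = Hom 𝟙 A
  ; _≈_ = λ x y → (n : ℕ) → eq A n (Func.to (comp x n) tt) (Func.to (comp y n) tt)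
  ; isEquivalence = record
      { refl = λ n → Setoid.refl (X A n)
      ; sym = λ e n → Setoid.sym (X A n) (e n)
      ; trans = λ e e' n → Setoid.trans (X A n) (e n) (e' n) } }

■ₒ : Obj → Obj
■ₒ A = record
  { X = λ _ → GlobalSetoid A
  ; restr = λ _ → record { to = λ x → x ; cong = λ e → e } }

-- Syntax of types of the guarded λ-calculus (de Bruijn, n free variables).
-- ■ takes a closed type (Ty 0), so "■A only for closed A" is built in.

data Ty (n : ℕ) : Set where
  var  : Fin n → Ty n
  `N   : Ty n
  `1   : Ty n
  `0   : Ty n
  _`×_ : Ty n → Ty n → Ty n
  _`+_ : Ty n → Ty n → Ty n
  _`→_ : Ty n → Ty n → Ty n
  `μ   : Ty (suc n) → Ty n
  `▶   : Ty n → Ty n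
  `■   : Ty 0 → Ty n

Guarded : {n : ℕ} → Fin n → Ty n → Set
Guarded i (var j) = ¬ (i ≡ j)
Guarded i `N = ⊤
Guarded i `1 = ⊤
Guarded i `0 = ⊤
Guarded i (A `× B) = Guarded i A × Guarded i B
Guarded i (A `+ B) = Guarded i A × Guarded i B
Guarded i (A `→ B) = Guarded i A × Guarded i B
Guarded i (`μ A) = Guarded (suc i) A
Guarded i (`▶ A) = ⊤
Guarded i (`■ A) = ⊤

WF : {n : ℕ} → Ty n → Set
WF (var j) = ⊤
WF `N = ⊤
WF `1 = ⊤
WF `0 = ⊤
WF (A `× B) = WF A × WF B
WF (A `+ B) = WF A × WF B
WF (A `→ B) = WF A × WF B
WF (`μ A) = Guarded zero A × WF A
WF (`▶ A) = WF A
WF (`■ A) = WF A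

Constant : {n : ℕ} → Ty n → Set
Constant (var j) = ⊤
Constant `N = ⊤
Constant `1 = ⊤
Constant `0 = ⊤
Constant (A `× B) = Constant A × Constant B
Constant (A `+ B) = Constant A × Constant B
Constant (A `→ B) = Constant A × Constant B
Constant (`μ A) = Constant A
Constant (`▶ A) = ⊥
Constant (`■ A) = ⊤

-- Env n assigns an object to each free variable (the diagonal
-- (W,W) of the paper's mixed-variance functor; on objects only the diagonal is
-- ever used, since μ substitutes (X,X)).  Den A ρ Z : "Z is [[A]](ρ)".

Env : ℕ → Set₁
Env n = Fin n → Obj

extend : {n : ℕ} → Env n → Obj → Env (suc n)
extend ρ Z zero = Z
extend ρ Z (suc i) = ρ i

emptyEnv : Env 0
emptyEnv ()

data Den {n : ℕ} : Ty n → Env n → Obj → Set₁ where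
  d-var  : ∀ {ρ} i → Den (var i) ρ (ρ i)
  d-N    : ∀ {ρ} → Den `N ρ (Δ ℕ)
  d-1    : ∀ {ρ} → Den `1 ρ (Δ ⊤)
  d-0    : ∀ {ρ} → Den `0 ρ (Δ ⊥)
  d-×    : ∀ {ρ A B P Q} → Den A ρ P → Den B ρ Q → Den (A `× B) ρ (P ×ₒ Q)
  d-+    : ∀ {ρ A B P Q} → Den A ρ P → Den B ρ Q → Den (A `+ B) ρ (P +ₒ Q)
  d-→    : ∀ {ρ A B P Q} → Den A ρ P → Den B ρ Q → Den (A `→ B) ρ (P ⇒ₒ Q)
  d-▶    : ∀ {ρ A P} → Den A ρ P → Den (`▶ A) ρ (▶ₒ P)
  d-■    : ∀ {ρ A P} → Den A emptyEnv P → Den (`■ A) ρ (■ₒ P)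
  d-μ    : ∀ {ρ A Z Y} → Den A (extend ρ Z) Y → Y ≅ Z → Den (`μ A) ρ Z

module Submission where

-- Every type former other than ▶ preserves constant objects: Δ Z and ■ X have identity
-- restrictions, pointwise products and coproducts of bijections are bijections, and
-- constancy is transported along the isomorphism [[A]](X) ≅ X defining μ.  For the
-- exponential of constant objects, naturality forces every element to be determined by
-- its component at stage 0, so its restrictions are bijective as well.  Finally, in a
-- constant type a guarded variable cannot occur at all (no ▶ outside ■, and ■ only
-- applies to closed types), so the variable bound by μ never has to be constant.

open import Defs
open import Data.Nat using (ℕ; zero; suc; _≤_; z≤n)
open import Data.Nat.Properties using (<⇒≤)
open import Data.Fin using (zero; suc)
open import Data.Unit using (⊤)
open import Data.Empty using (⊥; ⊥-elim)
open import Data.Product using (_,_; proj₁; proj₂)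
open import Data.Sum using (_⊎_; inj₁; inj₂; map₁)
open import Data.Product.Function.NonDependent.Setoid using (_×-bijection_)
open import Data.Sum.Function.Setoid using (_⊎-bijection_)
open import Relation.Binary using (Setoid)
import Relation.Binary.Reasoning.Setoid as SetoidReasoning
open import Relation.Binary.PropositionalEquality using (refl)
open import Function.Base using (_∘_)
open import Function.Bundles using (Func; Bijection)
open import Function.Definitions using (Injective; Surjective)

restr-bijection : (A : Obj) → IsConstant A → (n : ℕ) → Bijection (X A (suc n)) (X A n)
restr-bijection A c n = record { to = r A n ; cong = Func.cong (restr A n) ; bijective = c n }

lower : (A : Obj) (k : ℕ) → ∣ A ∣ k → ∣ A ∣ 0
lower A zero x = x
lower A (suc k) x = lower A k (r A k x)

lower-cong : (A : Obj) (k : ℕ) {x y : ∣ A ∣ k} → eq A k x y → eq A 0 (lower A k x) (lower A k y)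
lower-cong A zero e = e
lower-cong A (suc k) e = lower-cong A k (Func.cong (restr A k) e)

lower-natural : {P Q : Obj} {n : ℕ} (f : ExpElt P Q n) (k : ℕ) (p : k ≤ n) (x : ∣ P ∣ k) →
                eq Q 0 (lower Q k (fun f k p x)) (fun f 0 z≤n (lower P k x))
lower-natural {P} f zero p x = cong f 0 p z≤n x x (Setoid.refl (X P 0))
lower-natural {Q = Q} f (suc k) p x =
  Setoid.trans (X Q 0) (lower-cong Q k (natl f k p (<⇒≤ p) x)) (lower-natural f k (<⇒≤ p) _)

module ConstantObj (A : Obj) (c : IsConstant A) where
  private module A n = Setoid (X A n)

  restr⁻¹ : (n : ℕ) → ∣ A ∣ n → ∣ A ∣ (suc n)
  restr⁻¹ n y = proj₁ (proj₂ (c n) y)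

  restr∘restr⁻¹ : (n : ℕ) (y : ∣ A ∣ n) → eq A n (r A n (restr⁻¹ n y)) y
  restr∘restr⁻¹ n y = proj₂ (proj₂ (c n) y) (A.refl (suc n))

  restr-injective : (n : ℕ) {x y : ∣ A ∣ (suc n)} → eq A n (r A n x) (r A n y) → eq A (suc n) x y
  restr-injective n = proj₁ (c n)

  restr⁻¹-cong : (n : ℕ) {y y' : ∣ A ∣ n} → eq A n y y' →
                 eq A (suc n) (restr⁻¹ n y) (restr⁻¹ n y')
  restr⁻¹-cong n e = restr-injective n
    (A.trans n (restr∘restr⁻¹ n _) (A.trans n e (A.sym n (restr∘restr⁻¹ n _))))

  raise : (k : ℕ) → ∣ A ∣ 0 → ∣ A ∣ k
  raise zero y = y
  raise (suc k) y = restr⁻¹ k (raise k y)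

  raise-cong : (k : ℕ) {x y : ∣ A ∣ 0} → eq A 0 x y → eq A k (raise k x) (raise k y)
  raise-cong zero e = e
  raise-cong (suc k) e = restr⁻¹-cong k (raise-cong k e)

  raise∘lower : (k : ℕ) (x : ∣ A ∣ k) → eq A k (raise k (lower A k x)) x
  raise∘lower zero x = A.refl 0
  raise∘lower (suc k) x =
    restr-injective k (A.trans k (restr∘restr⁻¹ k _) (raise∘lower k (r A k x)))

IsConstant-Δ : (Z : Set) → IsConstant (Δ Z)
IsConstant-Δ Z n = (λ e → e) , (λ y → y , (λ e → e))

IsConstant-■ : (P : Obj) → IsConstant (■ₒ P)
IsConstant-■ P n = (λ e → e) , (λ y → y , (λ e → e))

IsConstant-× : (P Q : Obj) → IsConstant P → IsConstant Q → IsConstant (P ×ₒ Q)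
IsConstant-× P Q cp cq n =
  Bijection.bijective (restr-bijection P cp n ×-bijection restr-bijection Q cq n)

IsConstant-+ : (P Q : Obj) → IsConstant P → IsConstant Q → IsConstant (P +ₒ Q)
IsConstant-+ P Q cp cq n =
  Bijection.bijective (restr-bijection P cp n ⊎-bijection restr-bijection Q cq n)

module ConstantExponential (P Q : Obj) (cp : IsConstant P) (cq : IsConstant Q) where
  open ConstantObj Q cq

  stage0 : {n : ℕ} → ExpElt P Q n → Func (X P 0) (X Q 0)
  stage0 f = record { to = fun f 0 z≤n ; cong = cong f 0 z≤n z≤n _ _ }

  fromStage0 : {n : ℕ} → Func (X P 0) (X Q 0) → ExpElt P Q n
  fromStage0 φ = record
    { fun  = λ k _ x → raise k (Func.to φ (lower P k x))
    ; cong = λ k _ _ _ _ e → raise-cong k (Func.cong φ (lower-cong P k e))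
    ; natl = λ k _ _ _ → restr∘restr⁻¹ k _ }

  fromStage0-cong : {n : ℕ} {φ ψ : Func (X P 0) (X Q 0)} →
                    (∀ x → eq Q 0 (Func.to φ x) (Func.to ψ x)) →
                    eq (P ⇒ₒ Q) n (fromStage0 φ) (fromStage0 ψ)
  fromStage0-cong e k _ x = raise-cong k (e (lower P k x))

  stage0-determines : {n : ℕ} (f : ExpElt P Q n) → eq (P ⇒ₒ Q) n f (fromStage0 (stage0 f))
  stage0-determines f k p x = Setoid.trans (X Q k)
    (Setoid.sym (X Q k) (raise∘lower k (fun f k p x))) (raise-cong k (lower-natural f k p x))

  IsConstant-⇒ : IsConstant (P ⇒ₒ Q)
  IsConstant-⇒ n = (λ {f g} → injective {f} {g}) , surjective
    where
    injective : Injective (eq (P ⇒ₒ Q) (suc n)) (eq (P ⇒ₒ Q) n) (r (P ⇒ₒ Q) n)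
    injective {f} {g} e = begin
      f                      ≈⟨ stage0-determines f ⟩
      fromStage0 (stage0 f)  ≈⟨ fromStage0-cong {φ = stage0 f} {stage0 g} (e 0 z≤n) ⟩
      fromStage0 (stage0 g)  ≈⟨ stage0-determines g ⟨
      g                      ∎
      where open SetoidReasoning (X (P ⇒ₒ Q) (suc n))

    surjective : Surjective (eq (P ⇒ₒ Q) (suc n)) (eq (P ⇒ₒ Q) n) (r (P ⇒ₒ Q) n)
    surjective f = fromStage0 (stage0 f) , λ {h} h≈ → begin
      r (P ⇒ₒ Q) n h         ≈⟨ Func.cong (restr (P ⇒ₒ Q) n) {h} {fromStage0 (stage0 f)} h≈ ⟩
      fromStage0 (stage0 f)  ≈⟨ stage0-determines f ⟨
      f                      ∎
      where open SetoidReasoning (X (P ⇒ₒ Q) n)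

open ConstantExponential using (IsConstant-⇒)

IsConstant-resp-≅ : {Y Z : Obj} → Y ≅ Z → IsConstant Y → IsConstant Z
IsConstant-resp-≅ {Y} {Z} Y≅Z cy n = injective , surjective
  where
  open _≅_ Y≅Z
  module Y k = Setoid (X Y k)

  toₖ : (k : ℕ) → ∣ Y ∣ k → ∣ Z ∣ k
  toₖ k = Func.to (comp to k)

  fromₖ : (k : ℕ) → ∣ Z ∣ k → ∣ Y ∣ k
  fromₖ k = Func.to (comp from k)

  injective : Injective (eq Z (suc n)) (eq Z n) (r Z n)
  injective {x} {y} e = begin
    x                             ≈⟨ to∘from (suc n) x ⟨
    toₖ (suc n) (fromₖ (suc n) x) ≈⟨ Func.cong (comp to (suc n)) (proj₁ (cy n) from-r) ⟩
    toₖ (suc n) (fromₖ (suc n) y) ≈⟨ to∘from (suc n) y ⟩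
    y                             ∎
    where
    open SetoidReasoning (X Z (suc n))
    from-r : eq Y n (r Y n (fromₖ (suc n) x)) (r Y n (fromₖ (suc n) y))
    from-r = Y.trans n (nat from n x)
      (Y.trans n (Func.cong (comp from n) e) (Y.sym n (nat from n y)))

  surjective : Surjective (eq Z (suc n)) (eq Z n) (r Z n)
  surjective y = toₖ (suc n) w , λ {z} z≈ → begin
    r Z n z                 ≈⟨ Func.cong (restr Z n) z≈ ⟩
    r Z n (toₖ (suc n) w)   ≈⟨ nat to n w ⟩
    toₖ n (r Y n w)         ≈⟨ Func.cong (comp to n) r-w ⟩
    toₖ n (fromₖ n y)       ≈⟨ to∘from n y ⟩
    y                       ∎
    where
    open SetoidReasoning (X Z n)
    w : ∣ Y ∣ (suc n)
    w = proj₁ (proj₂ (cy n) (fromₖ n y))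
    r-w : eq Y n (r Y n w) (fromₖ n y)
    r-w = proj₂ (proj₂ (cy n) (fromₖ n y)) (Y.refl (suc n))

UnguardedConstant : {m : ℕ} → Ty m → Env m → Set
UnguardedConstant A ρ = ∀ j → Guarded j A ⊎ IsConstant (ρ j)

UnguardedConstant-μ : {m : ℕ} {A : Ty (suc m)} {ρ : Env m} {Z : Obj} → Guarded zero A →
                      UnguardedConstant (`μ A) ρ → UnguardedConstant A (extend ρ Z)
UnguardedConstant-μ g h zero = inj₁ g
UnguardedConstant-μ g h (suc j) = h j

Constant⇒IsConstant : {m : ℕ} {A : Ty m} {ρ : Env m} {Z : Obj} →
                      Den A ρ Z → WF A → Constant A → UnguardedConstant A ρ → IsConstant Z
Constant⇒IsConstant (d-var i) _ _ h with h i
... | inj₁ i≢i = ⊥-elim (i≢i refl)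
... | inj₂ c = c
Constant⇒IsConstant d-N _ _ _ = IsConstant-Δ ℕ
Constant⇒IsConstant d-1 _ _ _ = IsConstant-Δ ⊤
Constant⇒IsConstant d-0 _ _ _ = IsConstant-Δ ⊥
Constant⇒IsConstant (d-× {P = P} {Q = Q} d e) (w₁ , w₂) (c₁ , c₂) h = IsConstant-× P Q
  (Constant⇒IsConstant d w₁ c₁ (map₁ proj₁ ∘ h))
  (Constant⇒IsConstant e w₂ c₂ (map₁ proj₂ ∘ h))
Constant⇒IsConstant (d-+ {P = P} {Q = Q} d e) (w₁ , w₂) (c₁ , c₂) h = IsConstant-+ P Q
  (Constant⇒IsConstant d w₁ c₁ (map₁ proj₁ ∘ h))
  (Constant⇒IsConstant e w₂ c₂ (map₁ proj₂ ∘ h))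
Constant⇒IsConstant (d-→ {P = P} {Q = Q} d e) (w₁ , w₂) (c₁ , c₂) h = IsConstant-⇒ P Q
  (Constant⇒IsConstant d w₁ c₁ (map₁ proj₁ ∘ h))
  (Constant⇒IsConstant e w₂ c₂ (map₁ proj₂ ∘ h))
Constant⇒IsConstant (d-▶ _) _ () _
Constant⇒IsConstant (d-■ {P = P} _) _ _ _ = IsConstant-■ P
Constant⇒IsConstant (d-μ {A = A} d Y≅Z) (g , w) c h =
  IsConstant-resp-≅ Y≅Z (Constant⇒IsConstant d w c (UnguardedConstant-μ {A = A} g h))

lemma2p6 : (A : Ty 0) → WF A → Constant A →
           (Z : Obj) → Den A emptyEnv Z → IsConstant Z
lemma2p6 A w c Z d = Constant⇒IsConstant d w c (λ ())
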